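{- The complete bipartite graph $K_{2,4}$ does not admit any rigid orientation, while $K_{2,3}$ admits a rigid orientation.
   Context: An orientation of a simple graph assigns one direction to each edge. An automorphism of an oriented graph is a permutation $\phi$ of its vertices such that $\phi(u)\phi(v)$ is an arc whenever $uv$ is an arc; the oriented graph is rigid if its only automorphism is the identity. -}

module Defs where

open import Data.Nat using (ℕ; _+_; _<_; _≥_)
open import Data.Fin using (Fin; toℕ)
open import Data.Product using (_×_; Σ)
open import Data.Sum using (_⊎_)
open import Relation.Nullary using (¬_)
open import Relation.Binary.PropositionalEquality using (_≡_)
open import Function.Bundles using (_↔_; Inverse)

record Graph (n : ℕ) : Set₁ where
  field
    Adj   : Fin n → Fin n → Set
    irrefl : ∀ u → ¬ Adj u u
    sym    : ∀ u v → Adj u v → Adj v u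
open Graph public

K : (m k : ℕ) → Graph (m + k)
K m k = record
  { Adj = λ u v → (toℕ u < m × toℕ v ≥ m) ⊎ (toℕ u ≥ m × toℕ v < m)
  ; irrefl = irr
  ; sym = sy
  }
  where
  open import Data.Nat.Properties using (<⇒≱)
  open import Data.Sum using (inj₁; inj₂)
  open import Data.Product using (_,_)
  irr : ∀ u → ¬ ((toℕ u < m × toℕ u ≥ m) ⊎ (toℕ u ≥ m × toℕ u < m))
  irr u (inj₁ (a , b)) = <⇒≱ a b
  irr u (inj₂ (a , b)) = <⇒≱ b a
  sy : ∀ u v → (toℕ u < m × toℕ v ≥ m) ⊎ (toℕ u ≥ m × toℕ v < m)
             → (toℕ v < m × toℕ u ≥ m) ⊎ (toℕ v ≥ m × toℕ u < m)
  sy u v (inj₁ (a , b)) = inj₂ (b , a)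
  sy u v (inj₂ (a , b)) = inj₁ (b , a)

record Orientation {n : ℕ} (G : Graph n) : Set₁ where
  field
    Arc      : Fin n → Fin n → Set
    arc-edge : ∀ u v → Arc u v → Adj G u v
    one-dir  : ∀ u v → Adj G u v → Arc u v ⊎ Arc v u
    not-both : ∀ u v → Arc u v → ¬ Arc v u
open Orientation public

IsAutomorphism : {n : ℕ} {G : Graph n} → Orientation G → Fin n ↔ Fin n → Set
IsAutomorphism O φ = ∀ u v → Arc O u v → Arc O (Inverse.to φ u) (Inverse.to φ v)

Rigid : {n : ℕ} {G : Graph n} → Orientation G → Set
Rigid {n} O = (φ : Fin n ↔ Fin n) → IsAutomorphism O φ → ∀ u → Inverse.to φ u ≡ u

module Submission where

-- Write ℓ₀, ℓ₁ for the two vertices of the small side of K_{2,k} and r_j for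
-- the others.  Every edge joins the two sides, so a pair of permutations of
-- the sides is an automorphism of an orientation as soon as it preserves the
-- left-to-right arcs (lift-automorphism).  The profile of r_j records which
-- of ℓ₀ → r_j, ℓ₁ → r_j are arcs, one of the four values of Bool × Bool.
-- Two right vertices with equal profiles can be swapped (twins-not-rigid);
-- if a permutation of the right side turns every profile into its mirror
-- image, it can be combined with ℓ₀ ↔ ℓ₁ (mirror-not-rigid).  For k = 4
-- either two profiles coincide, or, an injection of Fin 4 into a 4-element
-- set being onto, all four occur and exchanging the vertices of profiles
-- (T,F) and (F,T) mirrors all profiles.
--
-- For K_{2,3} we orient the edges so that r₂ → ℓ₀ → r₁ → ℓ₁ → r₀ is the only
-- directed walk with four arcs.  Automorphisms map walks to walks, so they
-- fix this walk pointwise; as it visits every vertex, they are the identity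
-- (unique-spanning-walk⇒rigid).

open import Defs hiding (sym)
open import Data.Bool using (Bool; true; false; T)
open import Data.Bool.Properties using () renaming (_≟_ to _≟ᵇ_)
open import Data.Empty using (⊥; ⊥-elim)
open import Data.Fin using (Fin; zero; suc; _<_; _↑ˡ_; _↑ʳ_; inject₁; punchOut)
open import Data.Fin.Properties using (_≟_; <⇒≢; any?; pigeonhole; punchOut-injective; ↑ʳ-injective)
open import Data.Fin.Permutation using (Permutation′; _⟨$⟩ʳ_; _⟨$⟩ˡ_; inverseˡ; inverseʳ; transpose)
import Data.Fin.Permutation as Perm
import Data.Fin.Permutation.Components as PC
open import Data.Nat using (ℕ; _+_; s≤s; z≤n)
open import Data.Nat.Properties using (n<1+n)
open import Data.Product using (_×_; Σ; ∃; ∃₂; _,_; proj₁; proj₂; swap)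
open import Data.Product.Properties using (≡-dec)
open import Data.Sum using (_⊎_; inj₁; inj₂) renaming (swap to ⊎-swap)
open import Data.Vec using ([]; _∷_; lookup; tabulate)
open import Data.Vec.Properties using (lookup∘tabulate)
open import Function using (_∘_; Inverse; mk↔ₛ′)
open import Function.Definitions using (Injective)
open import Relation.Binary.Definitions using (DecidableEquality)
open import Relation.Binary.PropositionalEquality
open import Relation.Nullary using (¬_; Dec; yes; no; ¬?; contradiction)
open import Relation.Nullary.Decidable using (⌊_⌋; toWitness; fromWitness; decidable-stable; _×-dec_)

twins-or-injective : ∀ {n} {A : Set} → DecidableEquality A → (f : Fin n → A) →
                     (∃₂ λ i j → i ≢ j × f i ≡ f j) ⊎ Injective _≡_ _≡_ f
twins-or-injective _≟A_ f with any? (λ i → any? (λ j → ¬? (i ≟ j) ×-dec (f i ≟A f j)))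
... | yes (i , j , i≢j , fi≡fj) = inj₁ (i , j , i≢j , fi≡fj)
... | no no-twins = inj₂ λ {i} {j} fi≡fj →
  decidable-stable (i ≟ j) (λ i≢j → no-twins (i , j , i≢j , fi≡fj))

-- An injective self-map of Fin n is onto: a map missing a value y factors
-- through Fin n ∖ {y} ≅ Fin (n - 1), so the pigeonhole principle applies.
injective⇒surjective : ∀ {n} (f : Fin n → Fin n) → Injective _≡_ _≡_ f →
                       ∀ y → ∃ λ x → f x ≡ y
injective⇒surjective {ℕ.suc n} f f-inj y with any? (λ x → f x ≟ y)
... | yes hit = hit
... | no miss = ⊥-elim (collision (pigeonhole (n<1+n n) squeezed))
  where
  y≢f : ∀ x → y ≢ f x
  y≢f x y≡fx = miss (x , sym y≡fx)
  squeezed : Fin (ℕ.suc n) → Fin n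
  squeezed x = punchOut (y≢f x)
  collision : (∃₂ λ i j → i < j × squeezed i ≡ squeezed j) → ⊥
  collision (i , j , i<j , same) = <⇒≢ i<j (f-inj (punchOut-injective (y≢f i) (y≢f j) same))

transpose-cases : ∀ {n} {i j : Fin n} (P : Fin n → Fin n → Set) →
                  P i j → P j i → (∀ k → k ≢ i → k ≢ j → P k k) →
                  ∀ k → P k (PC.transpose i j k)
transpose-cases {i = i} {j} P Pij Pji Pkk k with k ≟ i
... | yes refl = Pij
... | no k≢i with k ≟ j
...   | yes refl = Pji
...   | no k≢j = Pkk k k≢i k≢j

transpose-moves : ∀ {n} (i j : Fin n) → PC.transpose i j i ≡ j
transpose-moves i j = transpose-cases (λ k k′ → k ≡ i → k′ ≡ j) (λ _ → refl)
  sym (λ k k≢i _ k≡i → contradiction k≡i k≢i) i refl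

left : ∀ {k} → Fin 2 → Fin (2 + k)
left {k} i = i ↑ˡ k

right : ∀ {k} → Fin k → Fin (2 + k)
right j = 2 ↑ʳ j

edge : ∀ {k} (i : Fin 2) (j : Fin k) → Adj (K 2 k) (left i) (right j)
edge zero       j = inj₁ (s≤s z≤n , s≤s (s≤s z≤n))
edge (suc zero) j = inj₁ (s≤s (s≤s z≤n) , s≤s (s≤s z≤n))

data Crossing {k : ℕ} : Fin (2 + k) → Fin (2 + k) → Set where
  left→right : ∀ i j → Crossing (left i) (right j)
  right→left : ∀ i j → Crossing (right j) (left i)

crossing : ∀ {k} (u v : Fin (2 + k)) → Adj (K 2 k) u v → Crossing u v
crossing zero             (suc (suc j))    _ = left→right zero j
crossing (suc zero)       (suc (suc j))    _ = left→right (suc zero) j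
crossing (suc (suc j))    zero             _ = right→left zero j
crossing (suc (suc j))    (suc zero)       _ = right→left (suc zero) j
crossing zero             zero             (inj₁ (_ , ()))
crossing zero             zero             (inj₂ (() , _))
crossing zero             (suc zero)       (inj₁ (_ , s≤s ()))
crossing zero             (suc zero)       (inj₂ (() , _))
crossing (suc zero)       zero             (inj₁ (_ , ()))
crossing (suc zero)       zero             (inj₂ (s≤s () , _))
crossing (suc zero)       (suc zero)       (inj₁ (_ , s≤s ()))
crossing (suc zero)       (suc zero)       (inj₂ (s≤s () , _))
crossing (suc (suc _))    (suc (suc _))    (inj₁ (s≤s (s≤s ()) , _))
crossing (suc (suc _))    (suc (suc _))    (inj₂ (_ , s≤s (s≤s ())))

module _ {k : ℕ} (O : Orientation (K 2 k)) where

  arc? : ∀ i j → Dec (Arc O (left i) (right j))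
  arc? i j with one-dir O (left i) (right j) (edge i j)
  ... | inj₁ ℓᵢ→rⱼ = yes ℓᵢ→rⱼ
  ... | inj₂ rⱼ→ℓᵢ = no (not-both O _ _ rⱼ→ℓᵢ)

  bit : Fin 2 → Fin k → Bool
  bit i j = ⌊ arc? i j ⌋

  transfer : ∀ {i j i′ j′} → bit i′ j′ ≡ bit i j →
             Arc O (left i) (right j) → Arc O (left i′) (right j′)
  transfer {i} {j} {i′} {j′} same arc =
    toWitness {a? = arc? i′ j′} (subst T (sym same) (fromWitness {a? = arc? i j} arc))

lift : ∀ {k} → (Fin 2 → Fin 2) → (Fin k → Fin k) → Fin (2 + k) → Fin (2 + k)
lift π σ zero          = left (π zero)
lift π σ (suc zero)    = left (π (suc zero))
lift π σ (suc (suc j)) = right (σ j)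

lift-left : ∀ {k} (π : Fin 2 → Fin 2) (σ : Fin k → Fin k) i → lift π σ (left i) ≡ left (π i)
lift-left π σ zero       = refl
lift-left π σ (suc zero) = refl

lift-inverse : ∀ {k} {π π′ : Fin 2 → Fin 2} {σ σ′ : Fin k → Fin k} →
               (∀ i → π (π′ i) ≡ i) → (∀ j → σ (σ′ j) ≡ j) →
               ∀ u → lift π σ (lift π′ σ′ u) ≡ u
lift-inverse {π = π} {π′} {σ} {σ′} ππ′ σσ′ = go
  where
  on-left : ∀ i → lift π σ (lift π′ σ′ (left i)) ≡ left i
  on-left i = begin
    lift π σ (lift π′ σ′ (left i)) ≡⟨ cong (lift π σ) (lift-left π′ σ′ i) ⟩
    lift π σ (left (π′ i))         ≡⟨ lift-left π σ (π′ i) ⟩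
    left (π (π′ i))                ≡⟨ cong left (ππ′ i) ⟩
    left i                         ∎
    where open ≡-Reasoning
  go : ∀ u → lift π σ (lift π′ σ′ u) ≡ u
  go zero          = on-left zero
  go (suc zero)    = on-left (suc zero)
  go (suc (suc j)) = cong right (σσ′ j)

lift-perm : ∀ {k} → Permutation′ 2 → Permutation′ k → Permutation′ (2 + k)
lift-perm π σ = mk↔ₛ′ (lift (π ⟨$⟩ʳ_) (σ ⟨$⟩ʳ_)) (lift (π ⟨$⟩ˡ_) (σ ⟨$⟩ˡ_))
  (lift-inverse (λ _ → inverseʳ π) (λ _ → inverseʳ σ))
  (lift-inverse (λ _ → inverseˡ π) (λ _ → inverseˡ σ))

-- If the side permutations preserve the incidence matrix, their lift is an
-- automorphism: left-to-right arcs are preserved by assumption, and a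
-- right-to-left arc r_j → ℓᵢ cannot become ℓ_{πi} → r_{σj}, since that arc
-- would transfer back to ℓᵢ → r_j.
lift-automorphism : ∀ {k} (O : Orientation (K 2 k)) (π : Permutation′ 2) (σ : Permutation′ k) →
                    (∀ i j → bit O (π ⟨$⟩ʳ i) (σ ⟨$⟩ʳ j) ≡ bit O i j) →
                    IsAutomorphism O (lift-perm π σ)
lift-automorphism O π σ preserves u v arc with crossing u v (arc-edge O u v arc)
... | left→right i j =
  subst (λ x → Arc O x (right (σ ⟨$⟩ʳ j))) (sym (lift-left _ _ i)) (transfer O (preserves i j) arc)
... | right→left i j with one-dir O (left (π ⟨$⟩ʳ i)) (right (σ ⟨$⟩ʳ j)) (edge _ _)
...   | inj₁ ℓ→r = ⊥-elim (not-both O _ _ arc (transfer O (sym (preserves i j)) ℓ→r))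
...   | inj₂ r→ℓ = subst (Arc O (right (σ ⟨$⟩ʳ j))) (sym (lift-left _ _ i)) r→ℓ

profile : ∀ {k} → Orientation (K 2 k) → Fin k → Bool × Bool
profile O j = bit O zero j , bit O (suc zero) j

twins-not-rigid : ∀ {k} (O : Orientation (K 2 k)) {j₁ j₂ : Fin k} →
                  j₁ ≢ j₂ → profile O j₁ ≡ profile O j₂ → ¬ Rigid O
twins-not-rigid O {j₁} {j₂} j₁≢j₂ twins rigid =
  j₁≢j₂ (sym (↑ʳ-injective 2 _ _ (trans (cong right (sym (transpose-moves j₁ j₂))) moved)))
  where
  σ : Permutation′ _
  σ = transpose j₁ j₂
  same-profile : ∀ j → profile O (σ ⟨$⟩ʳ j) ≡ profile O j
  same-profile = transpose-cases (λ j j′ → profile O j′ ≡ profile O j) (sym twins) twins (λ _ _ _ → refl)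
  preserves : ∀ i j → bit O (Perm.id ⟨$⟩ʳ i) (σ ⟨$⟩ʳ j) ≡ bit O i j
  preserves zero       j = cong proj₁ (same-profile j)
  preserves (suc zero) j = cong proj₂ (same-profile j)
  moved : right (σ ⟨$⟩ʳ j₁) ≡ right j₁
  moved = rigid (lift-perm Perm.id σ) (lift-automorphism O Perm.id σ preserves) (right j₁)

mirror-not-rigid : ∀ {k} (O : Orientation (K 2 k)) (σ : Permutation′ k) →
                   (∀ j → profile O (σ ⟨$⟩ʳ j) ≡ swap (profile O j)) → ¬ Rigid O
mirror-not-rigid O σ mirrors rigid =
  contradiction (rigid (lift-perm π σ) (lift-automorphism O π σ preserves) zero) λ ()
  where
  π : Permutation′ 2
  π = transpose zero (suc zero)
  preserves : ∀ i j → bit O (π ⟨$⟩ʳ i) (σ ⟨$⟩ʳ j) ≡ bit O i j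
  preserves zero       j = cong proj₂ (mirrors j)
  preserves (suc zero) j = cong proj₁ (mirrors j)

-- An injective encoding of the four profiles into Fin 4, so that counting
-- arguments on Fin 4 apply to profiles.
encode : Bool × Bool → Fin 4
encode (false , false) = zero
encode (false , true)  = suc zero
encode (true  , false) = suc (suc zero)
encode (true  , true)  = suc (suc (suc zero))

decode : Fin 4 → Bool × Bool
decode zero                   = false , false
decode (suc zero)             = false , true
decode (suc (suc zero))       = true  , false
decode (suc (suc (suc zero))) = true  , true

decode-encode : ∀ p → decode (encode p) ≡ p
decode-encode (false , false) = refl
decode-encode (false , true)  = refl
decode-encode (true  , false) = refl
decode-encode (true  , true)  = refl

encode-injective : Injective _≡_ _≡_ encode
encode-injective {p} {q} same = begin
  p                   ≡⟨ sym (decode-encode p) ⟩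
  decode (encode p)   ≡⟨ cong decode same ⟩
  decode (encode q)   ≡⟨ decode-encode q ⟩
  q                   ∎
  where open ≡-Reasoning

all-profiles-occur : (τ : Fin 4 → Bool × Bool) → Injective _≡_ _≡_ τ → ∀ p → ∃ λ j → τ j ≡ p
all-profiles-occur τ τ-inj p with injective⇒surjective (encode ∘ τ) (τ-inj ∘ encode-injective) (encode p)
... | j , hit = j , encode-injective hit

balanced : ∀ p → p ≢ (true , false) → p ≢ (false , true) → p ≡ swap p
balanced (false , false) _ _ = refl
balanced (true  , true)  _ _ = refl
balanced (true  , false) p≢TF _ = contradiction refl p≢TF
balanced (false , true)  _ p≢FT = contradiction refl p≢FT

mirroring-transposition : ∀ {k} (O : Orientation (K 2 k)) {j₁ j₂ : Fin k} →
                          Injective _≡_ _≡_ (profile O) →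
                          profile O j₁ ≡ (true , false) → profile O j₂ ≡ (false , true) →
                          ∀ j → profile O (transpose j₁ j₂ ⟨$⟩ʳ j) ≡ swap (profile O j)
mirroring-transposition O τ-inj τj₁ τj₂ =
  transpose-cases (λ j j′ → profile O j′ ≡ swap (profile O j))
    (trans τj₂ (cong swap (sym τj₁)))
    (trans τj₁ (cong swap (sym τj₂)))
    (λ j j≢j₁ j≢j₂ → balanced (profile O j)
       (λ τj≡TF → j≢j₁ (τ-inj (trans τj≡TF (sym τj₁))))
       (λ τj≡FT → j≢j₂ (τ-inj (trans τj≡FT (sym τj₂)))))

K₂₄-not-rigid : (O : Orientation (K 2 4)) → ¬ Rigid O
K₂₄-not-rigid O with twins-or-injective (≡-dec _≟ᵇ_ _≟ᵇ_) (profile O)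
... | inj₁ (_ , _ , j₁≢j₂ , twins) = twins-not-rigid O j₁≢j₂ twins
... | inj₂ τ-inj with all-profiles-occur (profile O) τ-inj (true , false)
                    | all-profiles-occur (profile O) τ-inj (false , true)
...   | j₁ , τj₁ | j₂ , τj₂ =
  mirror-not-rigid O (transpose j₁ j₂) (mirroring-transposition O τ-inj τj₁ τj₂)

Walk : ∀ {n} {G : Graph n} → Orientation G → (m : ℕ) → (Fin (ℕ.suc m) → Fin n) → Set
Walk O m w = ∀ (i : Fin m) → Arc O (w (inject₁ i)) (w (suc i))

-- Automorphisms map walks to walks.  So if w is the only walk with m arcs,
-- every automorphism fixes w pointwise, and if w visits every vertex the
-- automorphism is the identity.
unique-spanning-walk⇒rigid : ∀ {n m} {G : Graph n} (O : Orientation G) (w : Fin (ℕ.suc m) → Fin n) →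
                             Walk O m w → (∀ w′ → Walk O m w′ → ∀ i → w′ i ≡ w i) →
                             (∀ u → ∃ λ i → w i ≡ u) → Rigid O
unique-spanning-walk⇒rigid O w walk unique spanning φ automorphism u with spanning u
... | i , refl = unique (Inverse.to φ ∘ w) (λ i → automorphism _ _ (walk i)) i

ℓ₀ ℓ₁ r₀ r₁ r₂ : Fin 5
ℓ₀ = left zero
ℓ₁ = left (suc zero)
r₀ = right zero
r₁ = right (suc zero)
r₂ = right (suc (suc zero))

data _⟶_ : Fin 5 → Fin 5 → Set where
  ℓ₀⟶r₀ : ℓ₀ ⟶ r₀
  ℓ₀⟶r₁ : ℓ₀ ⟶ r₁
  ℓ₁⟶r₀ : ℓ₁ ⟶ r₀
  r₁⟶ℓ₁ : r₁ ⟶ ℓ₁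
  r₂⟶ℓ₀ : r₂ ⟶ ℓ₀
  r₂⟶ℓ₁ : r₂ ⟶ ℓ₁

⟶-edge : ∀ u v → u ⟶ v → Adj (K 2 3) u v
⟶-edge _ _ ℓ₀⟶r₀ = edge {3} zero zero
⟶-edge _ _ ℓ₀⟶r₁ = edge {3} zero (suc zero)
⟶-edge _ _ ℓ₁⟶r₀ = edge {3} (suc zero) zero
⟶-edge _ _ r₁⟶ℓ₁ = Graph.sym (K 2 3) _ _ (edge {3} (suc zero) (suc zero))
⟶-edge _ _ r₂⟶ℓ₀ = Graph.sym (K 2 3) _ _ (edge {3} zero (suc (suc zero)))
⟶-edge _ _ r₂⟶ℓ₁ = Graph.sym (K 2 3) _ _ (edge {3} (suc zero) (suc (suc zero)))

⟶-total : ∀ i j → (left i ⟶ right j) ⊎ (right j ⟶ left i)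
⟶-total zero       zero             = inj₁ ℓ₀⟶r₀
⟶-total zero       (suc zero)       = inj₁ ℓ₀⟶r₁
⟶-total zero       (suc (suc zero)) = inj₂ r₂⟶ℓ₀
⟶-total (suc zero) zero             = inj₁ ℓ₁⟶r₀
⟶-total (suc zero) (suc zero)       = inj₂ r₁⟶ℓ₁
⟶-total (suc zero) (suc (suc zero)) = inj₂ r₂⟶ℓ₁

⟶-asym : ∀ u v → u ⟶ v → ¬ v ⟶ u
⟶-asym _ _ ℓ₀⟶r₀ ()
⟶-asym _ _ ℓ₀⟶r₁ ()
⟶-asym _ _ ℓ₁⟶r₀ ()
⟶-asym _ _ r₁⟶ℓ₁ ()
⟶-asym _ _ r₂⟶ℓ₀ ()
⟶-asym _ _ r₂⟶ℓ₁ ()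

O₂₃ : Orientation (K 2 3)
O₂₃ = record
  { Arc      = _⟶_
  ; arc-edge = ⟶-edge
  ; one-dir  = one-dir′
  ; not-both = ⟶-asym
  }
  where
  one-dir′ : ∀ u v → Adj (K 2 3) u v → (u ⟶ v) ⊎ (v ⟶ u)
  one-dir′ u v e with crossing u v e
  ... | left→right i j = ⟶-total i j
  ... | right→left i j = ⊎-swap (⟶-total i j)

hamiltonian : Fin 5 → Fin 5
hamiltonian = lookup (r₂ ∷ ℓ₀ ∷ r₁ ∷ ℓ₁ ∷ r₀ ∷ [])

hamiltonian-walk : Walk O₂₃ 4 hamiltonian
hamiltonian-walk zero                   = r₂⟶ℓ₀
hamiltonian-walk (suc zero)             = ℓ₀⟶r₁
hamiltonian-walk (suc (suc zero))       = r₁⟶ℓ₁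
hamiltonian-walk (suc (suc (suc zero))) = ℓ₁⟶r₀

-- Every walk with four arcs is the Hamiltonian one: following the arcs,
-- all other attempts get stuck at a sink before the fourth step.
four-arcs-pinned : ∀ {v₀ v₁ v₂ v₃ v₄} → v₀ ⟶ v₁ → v₁ ⟶ v₂ → v₂ ⟶ v₃ → v₃ ⟶ v₄ →
                   v₀ ∷ v₁ ∷ v₂ ∷ v₃ ∷ v₄ ∷ [] ≡ r₂ ∷ ℓ₀ ∷ r₁ ∷ ℓ₁ ∷ r₀ ∷ []
four-arcs-pinned r₂⟶ℓ₀ ℓ₀⟶r₁ r₁⟶ℓ₁ ℓ₁⟶r₀ = refl
four-arcs-pinned r₂⟶ℓ₀ ℓ₀⟶r₀ () _
four-arcs-pinned r₂⟶ℓ₁ ℓ₁⟶r₀ () _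
four-arcs-pinned ℓ₀⟶r₁ r₁⟶ℓ₁ ℓ₁⟶r₀ ()
four-arcs-pinned ℓ₀⟶r₀ () _ _
four-arcs-pinned ℓ₁⟶r₀ () _ _
four-arcs-pinned r₁⟶ℓ₁ ℓ₁⟶r₀ () _

hamiltonian-unique : ∀ w → Walk O₂₃ 4 w → ∀ i → w i ≡ hamiltonian i
hamiltonian-unique w walk i = begin
  w i                      ≡⟨ sym (lookup∘tabulate w i) ⟩
  lookup (tabulate w) i    ≡⟨ cong (λ vs → lookup vs i) pinned ⟩
  hamiltonian i            ∎
  where
  open ≡-Reasoning
  pinned : tabulate w ≡ r₂ ∷ ℓ₀ ∷ r₁ ∷ ℓ₁ ∷ r₀ ∷ []
  pinned = four-arcs-pinned (walk zero) (walk (suc zero)) (walk (suc (suc zero))) (walk (suc (suc (suc zero))))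

hamiltonian-spanning : ∀ u → ∃ λ i → hamiltonian i ≡ u
hamiltonian-spanning zero                         = suc zero , refl
hamiltonian-spanning (suc zero)                   = suc (suc (suc zero)) , refl
hamiltonian-spanning (suc (suc zero))             = suc (suc (suc (suc zero))) , refl
hamiltonian-spanning (suc (suc (suc zero)))       = suc (suc zero) , refl
hamiltonian-spanning (suc (suc (suc (suc zero)))) = zero , refl

O₂₃-rigid : Rigid O₂₃
O₂₃-rigid = unique-spanning-walk⇒rigid O₂₃ hamiltonian hamiltonian-walk hamiltonian-unique hamiltonian-spanning

lemma17 : (¬ Σ (Orientation (K 2 4)) Rigid) × Σ (Orientation (K 2 3)) Rigid
lemma17 = (λ (O , rigid) → K₂₄-not-rigid O rigid) , (O₂₃ , O₂₃-rigid)
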